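{- Let $T$ be a $\beta(1,0)$-tree with $h(T)=T$. Then $T$ has exactly one of the following structures: (F0) $T$ is the one-node tree. (F1) There is a $\beta(1,0)$-tree $A$ such that $T$ is obtained as follows: take $h(A)$, change the label of its root to $1$ (unless it is $1$ already), and attach the root of the result by a new edge as a new rightmost child of the root of $A$; finally set the root label equal to the sum of the labels of its children. (F2) There are a $\beta(1,0)$-tree $A_1$, an integer $b>1$, and a $\beta(1,0)$-tree $A_2$ with at least two nodes, $h(A_2)=A_2$ and $\mathrm{root}(A_2)\ge b-1$, such that $T$ is obtained as follows: attach (the root of) $h(A_1)$ by a new edge as a new rightmost child of the $(b-1)$-th node on the rightmost path of $A_2$ (nodes on this path counted from the root, the root being the first); in the rightmost path of the resulting tree, add $1$ to the label of every non-root node from the $(b-1)$-th node upwards (if any), and set the label of the $b$-th node (the root of the attached copy of $h(A_1)$) to $1$; change the root label to $b$, and call the result $A_2'$. Then attach the root of $A_2'$ by a new edge as a new rightmost child of the root of $A_1$, and set the root label equal to the sum of the labels of its children. In particular, except for the one-node tree, $h$ has no fixed points with an odd number of nodes.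
   Context: A $\beta(1,0)$-tree is a rooted plane tree (the children of each node are linearly ordered from left to right) whose nodes are labeled with positive integers such that: leaves have label $1$; the root has label equal to the sum of its children's labels; every other node has label between $1$ and the sum of its children's labels. (The one-node tree consists of a single node with label $1$.) For a $\beta(1,0)$-tree $T$, $\mathrm{root}(T)$ is the label of the root, the rightmost path is the path from the root obtained by repeatedly passing to the rightmost child until reaching a leaf, and $\mathrm{rpath}(T)$ is the number of edges of the rightmost path. The depth of a node is its distance from the root. The map $h$ on $\beta(1,0)$-trees is defined recursively (it is a well-defined map with $\mathrm{rpath}(h(A))=\mathrm{root}(A)$ for every $A$ with at least two nodes): (i) $h$ maps the one-node tree and the one-edge tree to themselves. (ii) If the root of $T$ has exactly one child $v$, $v$ has label $c$, and $v$ is not a leaf: let $A$ be the subtree rooted at $v$, with the label of $v$ replaced by the sum of the labels of its children. Then $h(T)$ is obtained from $h(A)$ by attaching a new leaf (label $1$) as the new rightmost child of the node at depth $c-1$ on the rightmost path of $h(A)$, and increasing by $1$ the labels of all nodes on the rightmost path above the new leaf (i.e. at depths $0,1,\dots,c-1$). (iii) If the root of $T$ has at least two children: let $A$ be the tree formed by the root and all its subtrees except the rightmost one, with root label equal to the sum of the labels of those children, and let $B$ be the tree formed by the root and its rightmost subtree, with root label equal to the label of the rightmost child. Then $h(T)$ is obtained by identifying the rightmost leaf of $h(B)$ with the root of $h(A)$, the identified node keeping label $1$. -}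

module Defs where

open import Data.Nat using (ℕ; zero; suc; _+_; _∸_; _≤_)
open import Data.Nat.Divisibility using (_∣_)
open import Data.List using (List; []; _∷_; _++_)
open import Data.List.Relation.Unary.All using (All)
open import Data.Product using (Σ; _×_; _,_; proj₁; proj₂)
open import Relation.Binary.PropositionalEquality using (_≡_)

-- Rooted plane trees with ℕ labels (children ordered left to right)

data Tree : Set where
  node : ℕ → List Tree → Tree

label : Tree → ℕ
label (node n _) = n

children : Tree → List Tree
children (node _ ts) = ts

setLabel : ℕ → Tree → Tree
setLabel m (node _ ts) = node m ts

point : Tree
point = node 1 []

sumL : List Tree → ℕ
sumL [] = 0
sumL (t ∷ ts) = label t + sumL ts

mutual
  size : Tree → ℕ
  size (node _ ts) = suc (sizeL ts)

  sizeL : List Tree → ℕ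
  sizeL [] = 0
  sizeL (t ∷ ts) = size t + sizeL ts

-- condition on a non-root node
data Inner : Tree → Set where
  leaf     : Inner (node 1 [])
  internal : ∀ {n t ts} → 1 ≤ n → n ≤ sumL (t ∷ ts) → All Inner (t ∷ ts) →
             Inner (node n (t ∷ ts))

data Beta : Tree → Set where
  single : Beta (node 1 [])
  rooted : ∀ {n t ts} → n ≡ sumL (t ∷ ts) → All Inner (t ∷ ts) →
           Beta (node n (t ∷ ts))

-- attachAt d s t : attach s as new rightmost child of the node at depth d
-- on the rightmost path of t, adding 1 to the labels of the nodes at
-- depths 0,1,…,d of the rightmost path.  (Unchanged if the path is too short.)
mutual
  attachAt : ℕ → Tree → Tree → Tree
  attachAt zero s (node n ts) = node (suc n) (ts ++ s ∷ [])
  attachAt (suc d) s (node n []) = node n []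
  attachAt (suc d) s (node n (t ∷ ts)) = node (suc n) (attachL d s t ts)

  attachL : ℕ → Tree → Tree → List Tree → List Tree
  attachL d s t [] = attachAt d s t ∷ []
  attachL d s t (u ∷ us) = t ∷ attachL d s u us

-- graft b a : identify the rightmost leaf of b with the root of a;
-- the identified node gets label 1.
mutual
  graft : Tree → Tree → Tree
  graft (node n []) a = node 1 (children a)
  graft (node n (t ∷ ts)) a = node n (graftL t ts a)

  graftL : Tree → List Tree → Tree → List Tree
  graftL t [] a = graft t a ∷ []
  graftL t (u ∷ us) a = t ∷ graftL u us a

splitLast : Tree → List Tree → List Tree × Tree
splitLast t [] = [] , t
splitLast t (u ∷ us) = (t ∷ proj₁ (splitLast u us)) , proj₂ (splitLast u us)

-- The map h, defined with fuel; h t uses fuel = size t, which suffices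
-- since every recursive call is on a strictly smaller tree.

hF : ℕ → Tree → Tree
hF zero t = t
hF (suc k) (node n []) = node n []
hF (suc k) (node n (node c [] ∷ [])) = node n (node c [] ∷ [])
hF (suc k) (node n (node c (u ∷ us) ∷ [])) =
  attachAt (c ∸ 1) (node 1 []) (hF k (node (sumL (u ∷ us)) (u ∷ us)))
hF (suc k) (node n (t ∷ u ∷ ts)) =
  graft (hF k (node (label lst) (lst ∷ []))) (hF k (node (sumL ini) ini))
  where
  ini : List Tree
  ini = proj₁ (splitLast t (u ∷ ts))
  lst : Tree
  lst = proj₂ (splitLast t (u ∷ ts))

h : Tree → Tree
h t = hF (size t) t

hangRight : Tree → Tree → Tree
hangRight (node _ as) s = node (sumL (as ++ s ∷ [])) (as ++ s ∷ [])

F1tree : Tree → Tree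
F1tree A = hangRight A (setLabel 1 (h A))

-- A2' of (F2): the (b-1)-th node of the rightmost path is at depth b-2
A2′ : Tree → ℕ → Tree → Tree
A2′ A₁ b A₂ = setLabel b (attachAt (b ∸ 2) (setLabel 1 (h A₁)) A₂)

F2tree : Tree → ℕ → Tree → Tree
F2tree A₁ b A₂ = hangRight A₁ (A2′ A₁ b A₂)

IsF0 : Tree → Set
IsF0 T = T ≡ point

IsF1 : Tree → Set
IsF1 T = Σ Tree λ A → Beta A × T ≡ F1tree A

IsF2 : Tree → Set
IsF2 T = Σ Tree λ A₁ → Σ ℕ λ b → Σ Tree λ A₂ →
  Beta A₁ × 2 ≤ b × Beta A₂ × 2 ≤ size A₂ × h A₂ ≡ A₂ × b ∸ 1 ≤ label A₂ ×
  T ≡ F2tree A₁ b A₂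

module Submission where

-- Write a tree with at least two nodes as T = nrm (xs ∷ʳ S): its root, the
-- subtrees xs, and the rightmost subtree S = node (suc c) zs.  The key fact
-- 'h-shape' unfolds the definition of h once along the rightmost child:
--     h T = attachAt c (setLabel 1 (h (nrm xs))) (h (nrm zs)),
-- i.e. h (nrm xs), relabelled 1, hangs at depth c of the rightmost path of
-- h (nrm zs).
--
-- By induction on size, h preserves normality and size and turns
-- the root label into the length of the rightmost path ('preserves').  For a
-- fixed point, comparing the rightmost children of T and h T gives (F1) when
-- c = 0 and (F2) when c ≥ 1; in the latter case A₂ is a fixed point by
-- 'last-child', which tracks the last child of h through attachments on the
-- rightmost path.  The size formulas of (F1), (F2) and induction give parity.

open import Defs
open import Data.Empty using (⊥-elim)
open import Data.List using (List; []; _∷_; _∷ʳ_; initLast; _∷ʳ′_)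
open import Data.List.Properties using (∷ʳ-injective; ++-conicalʳ)
open import Data.List.Relation.Unary.All using (All; []; _∷_)
open import Data.List.Relation.Unary.All.Properties using (∷ʳ⁺; ∷ʳ⁻)
open import Data.Nat using (ℕ; zero; suc; _+_; _∸_; _≤_; _<_; z≤n; s≤s)
open import Data.Nat.Divisibility using (_∣_; m∣m*n; ∣m∣n⇒∣m+n)
open import Data.Nat.Properties
open import Data.Product using (_×_; _,_; proj₁; proj₂)
open import Data.Sum using (_⊎_; inj₁; inj₂)
open import Relation.Nullary using (¬_)
open import Relation.Binary.PropositionalEquality

nrm : List Tree → Tree
nrm ts = node (sumL ts) ts

_≈ᶜ_ : Tree → Tree → Set
t ≈ᶜ u = children t ≡ children u

mutual
  rpath : Tree → ℕ
  rpath (node _ []) = 0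
  rpath (node _ (t ∷ ts)) = suc (rpathL t ts)

  rpathL : Tree → List Tree → ℕ
  rpathL t [] = rpath t
  rpathL t (u ∷ us) = rpathL u us

-- These are the β(1,0)-trees with
-- at least two nodes, plus the degenerate node 0 [] = nrm [].
data Normal : Tree → Set where
  normal : ∀ {ts} → All Inner ts → Normal (nrm ts)

data Positive : Tree → Set where
  positive : ∀ c zs → Positive (node (suc c) zs)

∷ʳ-elim : {A : Set} (P : List A → Set) → (∀ xs x → P (xs ∷ʳ x)) → ∀ t ts → P (t ∷ ts)
∷ʳ-elim P f t [] = f [] t
∷ʳ-elim P f t (u ∷ us) = ∷ʳ-elim (λ ys → P (t ∷ ys)) (λ xs x → f (t ∷ xs) x) u us

sumL-∷ʳ : ∀ xs x → sumL (xs ∷ʳ x) ≡ sumL xs + label x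
sumL-∷ʳ [] x = +-identityʳ (label x)
sumL-∷ʳ (y ∷ ys) x = trans (cong (label y +_) (sumL-∷ʳ ys x)) (sym (+-assoc (label y) _ _))

sumL-∷ʳ-suc : ∀ xs x y → label y ≡ suc (label x) → sumL (xs ∷ʳ y) ≡ suc (sumL (xs ∷ʳ x))
sumL-∷ʳ-suc xs x y e = begin
  sumL (xs ∷ʳ y)            ≡⟨ sumL-∷ʳ xs y ⟩
  sumL xs + label y         ≡⟨ cong (sumL xs +_) e ⟩
  sumL xs + suc (label x)   ≡⟨ +-suc (sumL xs) (label x) ⟩
  suc (sumL xs + label x)   ≡⟨ cong suc (sym (sumL-∷ʳ xs x)) ⟩
  suc (sumL (xs ∷ʳ x))      ∎
  where open ≡-Reasoning

sizeL-∷ʳ : ∀ xs x → sizeL (xs ∷ʳ x) ≡ sizeL xs + size x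
sizeL-∷ʳ [] x = +-identityʳ (size x)
sizeL-∷ʳ (y ∷ ys) x = trans (cong (size y +_) (sizeL-∷ʳ ys x)) (sym (+-assoc (size y) _ _))

size-pos : ∀ t → 1 ≤ size t
size-pos (node _ _) = s≤s z≤n

sizeL-∷ʳ-parts : ∀ {k} xs x → sizeL (xs ∷ʳ x) < suc k → sizeL xs < k × size x ≤ k
sizeL-∷ʳ-parts xs x (s≤s le) rewrite sizeL-∷ʳ xs x =
  ≤-trans (m<m+n (sizeL xs) (size-pos x)) le , ≤-trans (m≤n+m (size x) (sizeL xs)) le

rpath-∷ʳ : ∀ n xs x → rpath (node n (xs ∷ʳ x)) ≡ suc (rpath x)
rpath-∷ʳ n [] x = refl
rpath-∷ʳ n (y ∷ ys) x = cong suc (rpathL-∷ʳ y ys)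
  where
  rpathL-∷ʳ : ∀ y ys → rpathL y (ys ∷ʳ x) ≡ rpath x
  rpathL-∷ʳ y [] = refl
  rpathL-∷ʳ y (z ∷ zs) = rpathL-∷ʳ z zs

rpath-last : ∀ {j} n xs x → suc j ≤ rpath (node n (xs ∷ʳ x)) → j ≤ rpath x
rpath-last n xs x le = ≤-pred (subst (_ ≤_) (rpath-∷ʳ n xs x) le)

rpath-≈ : ∀ {t u} → t ≈ᶜ u → rpath t ≡ rpath u
rpath-≈ {node _ []} {node _ .[]} refl = refl
rpath-≈ {node _ (_ ∷ _)} {node _ .(_ ∷ _)} refl = refl

label-setLabel : ∀ k t → label (setLabel k t) ≡ k
label-setLabel k (node _ _) = refl

setLabel-≈ : ∀ k t → setLabel k t ≈ᶜ t
setLabel-≈ k (node _ _) = refl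

setLabel-children : ∀ k t → setLabel k t ≡ node k (children t)
setLabel-children k (node _ _) = refl

label-eta : ∀ {k} t → label t ≡ k → t ≡ node k (children t)
label-eta (node _ _) refl = refl

size-setLabel : ∀ k t → size (setLabel k t) ≡ size t
size-setLabel k (node _ _) = refl

Inner-pos : ∀ {t} → Inner t → 1 ≤ label t
Inner-pos leaf = s≤s z≤n
Inner-pos (internal p _ _) = p

Inner-children : ∀ {t} → Inner t → All Inner (children t)
Inner-children leaf = []
Inner-children (internal _ _ a) = a

Inner⇒Positive : ∀ {t} → Inner t → Positive t
Inner⇒Positive leaf = positive 0 []
Inner⇒Positive (internal {suc c} _ _ _) = positive c _

Inner-depth : ∀ {c zs} → Inner (node (suc c) zs) → c ≡ 0 ⊎ c < sumL zs
Inner-depth leaf = inj₁ refl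
Inner-depth (internal _ q _) = inj₂ q

Inner-depth-< : ∀ {d zs} → Inner (node (suc (suc d)) zs) → suc d < sumL zs
Inner-depth-< (internal _ q _) = q

depth-≤ : ∀ {c r} → c ≡ 0 ⊎ c < r → c ≤ r
depth-≤ (inj₁ refl) = z≤n
depth-≤ (inj₂ lt) = <⇒≤ lt

sumL-pos : ∀ {t ts} → All Inner (t ∷ ts) → 1 ≤ sumL (t ∷ ts)
sumL-pos {t} {ts} (it ∷ _) = ≤-trans (Inner-pos it) (m≤m+n (label t) (sumL ts))

-- Smart constructors: nonemptiness of the children follows from the label bounds.
mkInner : ∀ {n} ys → 1 ≤ n → n ≤ sumL ys → All Inner ys → Inner (node n ys)
mkInner [] (s≤s z≤n) () _
mkInner (_ ∷ _) p q a = internal p q a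

mkNormal : ∀ {n} ys → n ≡ sumL ys → All Inner ys → Normal (node n ys)
mkNormal ys refl a = normal a

Normal-eta : ∀ {P} → Normal P → P ≡ nrm (children P)
Normal-eta (normal _) = refl

Normal⇒Inner-setLabel1 : ∀ {P} → Normal P → Inner (setLabel 1 P)
Normal⇒Inner-setLabel1 (normal {[]} []) = leaf
Normal⇒Inner-setLabel1 (normal {_ ∷ _} a) = internal (s≤s z≤n) (sumL-pos a) a

attachAt-∷ʳ : ∀ j s n xs x → attachAt (suc j) s (node n (xs ∷ʳ x)) ≡ node (suc n) (xs ∷ʳ attachAt j s x)
attachAt-∷ʳ j s n [] x = refl
attachAt-∷ʳ j s n (y ∷ ys) x = cong (node (suc n)) (attachL-∷ʳ y ys)
  where
  attachL-∷ʳ : ∀ y ys → attachL j s y (ys ∷ʳ x) ≡ y ∷ ys ∷ʳ attachAt j s x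
  attachL-∷ʳ y [] = refl
  attachL-∷ʳ y (z ∷ zs) = cong (y ∷_) (attachL-∷ʳ z zs)

graft-∷ʳ : ∀ n xs x a → graft (node n (xs ∷ʳ x)) a ≡ node n (xs ∷ʳ graft x a)
graft-∷ʳ n [] x a = refl
graft-∷ʳ n (y ∷ ys) x a = cong (node n) (graftL-∷ʳ y ys)
  where
  graftL-∷ʳ : ∀ y ys → graftL y (ys ∷ʳ x) a ≡ y ∷ ys ∷ʳ graft x a
  graftL-∷ʳ y [] = refl
  graftL-∷ʳ y (z ∷ zs) = cong (y ∷_) (graftL-∷ʳ z zs)

children-attachAt₀ : ∀ s t → children (attachAt 0 s t) ≡ children t ∷ʳ s
children-attachAt₀ s (node _ _) = refl

attachAt-≈ : ∀ j s {t u} → t ≈ᶜ u → attachAt j s t ≈ᶜ attachAt j s u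
attachAt-≈ zero s {node _ _} {node _ _} refl = refl
attachAt-≈ (suc j) s {node _ []} {node _ .[]} refl = refl
attachAt-≈ (suc j) s {node _ (_ ∷ _)} {node _ .(_ ∷ _)} refl = refl

label-attachAt : ∀ j s t → j ≤ rpath t → label (attachAt j s t) ≡ suc (label t)
label-attachAt zero s (node n ts) _ = refl
label-attachAt (suc j) s (node n (t ∷ ts)) _ = refl

rpath-attachAt : ∀ j s t → j ≤ rpath t → rpath (attachAt j s t) ≡ suc (j + rpath s)
rpath-attachAt zero s (node n ts) _ = rpath-∷ʳ (suc n) ts s
rpath-attachAt (suc j) s (node n ts) le with initLast ts
... | xs ∷ʳ′ x = begin
  rpath (attachAt (suc j) s (node n (xs ∷ʳ x)))  ≡⟨ cong rpath (attachAt-∷ʳ j s n xs x) ⟩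
  rpath (node (suc n) (xs ∷ʳ attachAt j s x))   ≡⟨ rpath-∷ʳ (suc n) xs _ ⟩
  suc (rpath (attachAt j s x))                  ≡⟨ cong suc (rpath-attachAt j s x (rpath-last n xs x le)) ⟩
  suc (suc j + rpath s)                         ∎
  where open ≡-Reasoning

size-attachAt : ∀ j s t → j ≤ rpath t → size (attachAt j s t) ≡ size t + size s
size-attachAt zero s (node n ts) _ = cong suc (sizeL-∷ʳ ts s)
size-attachAt (suc j) s (node n ts) le with initLast ts
... | xs ∷ʳ′ x = begin
  size (attachAt (suc j) s (node n (xs ∷ʳ x)))  ≡⟨ cong size (attachAt-∷ʳ j s n xs x) ⟩
  suc (sizeL (xs ∷ʳ attachAt j s x))           ≡⟨ cong suc (sizeL-∷ʳ xs _) ⟩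
  suc (sizeL xs + size (attachAt j s x))       ≡⟨ cong (λ m → suc (sizeL xs + m)) (size-attachAt j s x (rpath-last n xs x le)) ⟩
  suc (sizeL xs + (size x + size s))           ≡⟨ cong suc (sym (+-assoc (sizeL xs) _ _)) ⟩
  suc (sizeL xs + size x + size s)             ≡⟨ cong (λ m → suc (m + size s)) (sym (sizeL-∷ʳ xs x)) ⟩
  size (node n (xs ∷ʳ x)) + size s             ∎
  where open ≡-Reasoning

graft-attachAt : ∀ d L a → d ≤ rpath L → graft (attachAt d point L) a ≡ attachAt d (setLabel 1 a) L
graft-attachAt zero (node n ts) a _ =
  trans (graft-∷ʳ (suc n) ts point a) (cong (λ z → node (suc n) (ts ∷ʳ z)) (sym (setLabel-children 1 a)))
graft-attachAt (suc d) (node n ts) a le with initLast ts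
... | xs ∷ʳ′ x = begin
  graft (attachAt (suc d) point (node n (xs ∷ʳ x))) a  ≡⟨ cong (λ t → graft t a) (attachAt-∷ʳ d point n xs x) ⟩
  graft (node (suc n) (xs ∷ʳ attachAt d point x)) a   ≡⟨ graft-∷ʳ (suc n) xs _ a ⟩
  node (suc n) (xs ∷ʳ graft (attachAt d point x) a)   ≡⟨ cong (λ z → node (suc n) (xs ∷ʳ z)) (graft-attachAt d x a (rpath-last n xs x le)) ⟩
  node (suc n) (xs ∷ʳ attachAt d (setLabel 1 a) x)    ≡⟨ sym (attachAt-∷ʳ d _ n xs x) ⟩
  attachAt (suc d) (setLabel 1 a) (node n (xs ∷ʳ x))  ∎
  where open ≡-Reasoning

Inner-∷ʳ : ∀ {n} xs {x} → Inner (node n (xs ∷ʳ x)) → n ≤ sumL (xs ∷ʳ x) × All Inner (xs ∷ʳ x)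
Inner-∷ʳ [] (internal _ q a) = q , a
Inner-∷ʳ (_ ∷ _) (internal _ q a) = q , a

-- Attaching a valid node strictly above the end of the rightmost path keeps
-- the β(1,0) condition: the labels on the path grow by one, as do their sums.
Inner-attachAt : ∀ j s Y → j < rpath Y → Inner s → Inner Y → Inner (attachAt j s Y)
Inner-attachAt zero s (node n (t ∷ ts)) _ is (internal _ q a) =
  internal (s≤s z≤n) bound (∷ʳ⁺ a is)
  where
  bound : suc n ≤ sumL ((t ∷ ts) ∷ʳ s)
  bound = subst (suc n ≤_) (sym (sumL-∷ʳ (t ∷ ts) s))
            (subst (_≤ sumL (t ∷ ts) + label s) (+-comm n 1) (+-mono-≤ q (Inner-pos is)))
Inner-attachAt (suc j) s (node n ts) lt is iY with initLast ts
... | xs ∷ʳ′ x rewrite attachAt-∷ʳ j s n xs x =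
  mkInner (xs ∷ʳ y) (s≤s z≤n)
    (subst (suc n ≤_) (sym (sumL-∷ʳ-suc xs x y (label-attachAt j s x (<⇒≤ lt′)))) (s≤s q))
    (∷ʳ⁺ (proj₁ (∷ʳ⁻ {xs = xs} a)) (Inner-attachAt j s x lt′ is (proj₂ (∷ʳ⁻ {xs = xs} a))))
  where
  lt′ : j < rpath x
  lt′ = rpath-last n xs x lt
  y : Tree
  y = attachAt j s x
  q : n ≤ sumL (xs ∷ʳ x)
  q = proj₁ (Inner-∷ʳ xs iY)
  a : All Inner (xs ∷ʳ x)
  a = proj₂ (Inner-∷ʳ xs iY)

Normal-attachAt : ∀ j s H → j ≡ 0 ⊎ j < rpath H → Inner s → label s ≡ 1 → Normal H → Normal (attachAt j s H)
Normal-attachAt zero s _ _ is ls (normal {ts} a) =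
  mkNormal (ts ∷ʳ s) (sym (trans (sumL-∷ʳ ts s) (trans (cong (sumL ts +_) ls) (+-comm (sumL ts) 1)))) (∷ʳ⁺ a is)
Normal-attachAt (suc j) s _ (inj₂ lt) is ls (normal {ts} a) with initLast ts
... | xs ∷ʳ′ x rewrite attachAt-∷ʳ j s (sumL (xs ∷ʳ x)) xs x =
  mkNormal (xs ∷ʳ y) (sym (sumL-∷ʳ-suc xs x y (label-attachAt j s x (<⇒≤ lt′))))
    (∷ʳ⁺ (proj₁ (∷ʳ⁻ {xs = xs} a)) (Inner-attachAt j s x lt′ is (proj₂ (∷ʳ⁻ {xs = xs} a))))
  where
  lt′ : j < rpath x
  lt′ = rpath-last (sumL (xs ∷ʳ x)) xs x lt
  y : Tree
  y = attachAt j s x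

hF-case-iii : ∀ k n t u ts → hF (suc k) (node n (t ∷ u ∷ ts)) ≡
  graft (hF k (node (label (proj₂ (splitLast t (u ∷ ts)))) (proj₂ (splitLast t (u ∷ ts)) ∷ [])))
        (hF k (nrm (proj₁ (splitLast t (u ∷ ts)))))
hF-case-iii k n (node _ []) u ts = refl
hF-case-iii k n (node _ (_ ∷ _)) u ts = refl

splitLast-∷ʳ : ∀ y ys x → splitLast y (ys ∷ʳ x) ≡ (y ∷ ys , x)
splitLast-∷ʳ y [] x = refl
splitLast-∷ʳ y (z ∷ zs) x rewrite splitLast-∷ʳ z zs x = refl

hF-∷ʳ : ∀ k n i is x →
  hF (suc k) (node n ((i ∷ is) ∷ʳ x)) ≡ graft (hF k (node (label x) (x ∷ []))) (hF k (nrm (i ∷ is)))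
hF-∷ʳ k n i [] x = hF-case-iii k n i x []
hF-∷ʳ k n i (j ∷ js) x =
  trans (hF-case-iii k n i j (js ∷ʳ x))
        (cong (λ p → graft (hF k (node (label (proj₂ p)) (proj₂ p ∷ []))) (hF k (nrm (i ∷ proj₁ p))))
              (splitLast-∷ʳ j js x))

∷ʳ-calls-smaller : ∀ {k} n i is x → size (node n ((i ∷ is) ∷ʳ x)) ≤ suc k →
  size (node (label x) (x ∷ [])) ≤ k × size (nrm (i ∷ is)) ≤ k
∷ʳ-calls-smaller {k} n i is x (s≤s le) rewrite sizeL-∷ʳ (i ∷ is) x =
  ≤-trans (subst (_≤ sizeL (i ∷ is) + size x) (cong suc (sym (+-identityʳ (size x))))
                 (m<n+m (size x) (≤-trans (size-pos i) (m≤m+n (size i) (sizeL is))))) le ,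
  ≤-trans (m<m+n (sizeL (i ∷ is)) (size-pos x)) le

hF-fuel : ∀ k k′ t → size t ≤ k → size t ≤ k′ → hF k t ≡ hF k′ t
hF-fuel zero k′ (node _ _) () _
hF-fuel (suc k) zero (node _ _) _ ()
hF-fuel (suc k) (suc k′) (node n []) _ _ = refl
hF-fuel (suc k) (suc k′) (node n (node c [] ∷ [])) _ _ = refl
hF-fuel (suc k) (suc k′) (node n (node c (u ∷ us) ∷ [])) (s≤s p) (s≤s q) =
  cong (attachAt (c ∸ 1) point) (hF-fuel k k′ _ (≤-trans (m≤m+n _ 0) p) (≤-trans (m≤m+n _ 0) q))
hF-fuel (suc k) (suc k′) (node n (t ∷ u ∷ ts)) =
  ∷ʳ-elim (λ ys → size (node n (t ∷ ys)) ≤ suc k → size (node n (t ∷ ys)) ≤ suc k′ →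
                   hF (suc k) (node n (t ∷ ys)) ≡ hF (suc k′) (node n (t ∷ ys)))
    step u ts
  where
  step : ∀ xs x → size (node n ((t ∷ xs) ∷ʳ x)) ≤ suc k → size (node n ((t ∷ xs) ∷ʳ x)) ≤ suc k′ →
         hF (suc k) (node n ((t ∷ xs) ∷ʳ x)) ≡ hF (suc k′) (node n ((t ∷ xs) ∷ʳ x))
  step xs x p q with ∷ʳ-calls-smaller n t xs x p | ∷ʳ-calls-smaller n t xs x q
  ... | pB , pA | qB , qA = begin
    hF (suc k) (node n ((t ∷ xs) ∷ʳ x))                             ≡⟨ hF-∷ʳ k n t xs x ⟩
    graft (hF k (node (label x) (x ∷ []))) (hF k (nrm (t ∷ xs)))    ≡⟨ cong₂ graft (hF-fuel k k′ _ pB qB) (hF-fuel k k′ _ pA qA) ⟩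
    graft (hF k′ (node (label x) (x ∷ []))) (hF k′ (nrm (t ∷ xs)))  ≡⟨ sym (hF-∷ʳ k′ n t xs x) ⟩
    hF (suc k′) (node n ((t ∷ xs) ∷ʳ x))                            ∎
    where open ≡-Reasoning

hF-h : ∀ k t → size t ≤ k → hF k t ≡ h t
hF-h k t le = hF-fuel k (size t) t le ≤-refl

h-single : ∀ n c u us → h (node n (node c (u ∷ us) ∷ [])) ≡ attachAt (c ∸ 1) point (h (nrm (u ∷ us)))
h-single n c u us = cong (attachAt (c ∸ 1) point) (hF-h _ (nrm (u ∷ us)) (m≤m+n _ 0))

h-∷ʳ : ∀ n i is x → h (node n ((i ∷ is) ∷ʳ x)) ≡ graft (h (node (label x) (x ∷ []))) (h (nrm (i ∷ is)))
h-∷ʳ n i is x with ∷ʳ-calls-smaller n i is x ≤-refl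
... | pB , pA = trans (hF-∷ʳ _ n i is x) (cong₂ graft (hF-h _ _ pB) (hF-h _ _ pA))

h-shape : ∀ xs c zs → c ≤ rpath (h (nrm zs)) →
  h (nrm (xs ∷ʳ node (suc c) zs)) ≡ attachAt c (setLabel 1 (h (nrm xs))) (h (nrm zs))
h-shape [] .0 [] z≤n = refl
h-shape (i ∷ is) .0 [] z≤n =
  trans (h-∷ʳ _ i is point) (cong (λ t → node 1 (t ∷ [])) (sym (setLabel-children 1 (h (nrm (i ∷ is))))))
h-shape [] c (u ∷ us) _ = h-single (suc c + 0) (suc c) u us
h-shape (i ∷ is) c (u ∷ us) le = begin
  h (nrm ((i ∷ is) ∷ʳ S))             ≡⟨ h-∷ʳ _ i is S ⟩
  graft (h (node (suc c) (S ∷ []))) A ≡⟨ cong (λ t → graft t A) (h-single (suc c) (suc c) u us) ⟩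
  graft (attachAt c point H) A        ≡⟨ graft-attachAt c H A le ⟩
  attachAt c (setLabel 1 A) H         ∎
  where
  open ≡-Reasoning
  S = node (suc c) (u ∷ us)
  A = h (nrm (i ∷ is))
  H = h (nrm (u ∷ us))

Preserved : Tree → Set
Preserved T = Normal (h T) × rpath (h T) ≡ label T × size (h T) ≡ size T

preserved-∷ʳ : ∀ xs c zs → Inner (node (suc c) zs) →
  Preserved (nrm xs) → Preserved (nrm zs) → Preserved (nrm (xs ∷ʳ node (suc c) zs))
preserved-∷ʳ xs c zs iS (nA , rA , sA) (nH , rH , sH) =
  subst Normal (sym shape) (Normal-attachAt c s H depth (Normal⇒Inner-setLabel1 nA) (label-setLabel 1 A) nH) ,
  trans (cong rpath shape) rpath-eq ,
  trans (cong size shape) size-eq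
  where
  A = h (nrm xs)
  H = h (nrm zs)
  s = setLabel 1 A
  depth : c ≡ 0 ⊎ c < rpath H
  depth = subst (λ r → c ≡ 0 ⊎ c < r) (sym rH) (Inner-depth iS)
  shape : h (nrm (xs ∷ʳ node (suc c) zs)) ≡ attachAt c s H
  shape = h-shape xs c zs (depth-≤ depth)
  open ≡-Reasoning
  rpath-eq : rpath (attachAt c s H) ≡ sumL (xs ∷ʳ node (suc c) zs)
  rpath-eq = begin
    rpath (attachAt c s H)   ≡⟨ rpath-attachAt c s H (depth-≤ depth) ⟩
    suc (c + rpath s)        ≡⟨ cong (λ r → suc (c + r)) (trans (rpath-≈ (setLabel-≈ 1 A)) rA) ⟩
    suc c + sumL xs          ≡⟨ +-comm (suc c) (sumL xs) ⟩
    sumL xs + suc c          ≡⟨ sym (sumL-∷ʳ xs _) ⟩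
    sumL (xs ∷ʳ node (suc c) zs) ∎
  size-eq : size (attachAt c s H) ≡ size (nrm (xs ∷ʳ node (suc c) zs))
  size-eq = begin
    size (attachAt c s H)                ≡⟨ size-attachAt c s H (depth-≤ depth) ⟩
    size H + size s                      ≡⟨ cong₂ _+_ sH (trans (size-setLabel 1 A) sA) ⟩
    suc (sizeL zs) + suc (sizeL xs)      ≡⟨ +-comm (suc (sizeL zs)) (suc (sizeL xs)) ⟩
    suc (sizeL xs + suc (sizeL zs))      ≡⟨ cong suc (sym (sizeL-∷ʳ xs _)) ⟩
    size (nrm (xs ∷ʳ node (suc c) zs))   ∎

preserves-nrm : ∀ k ts → sizeL ts < k → All Inner ts → Preserved (nrm ts)
preserves-nrm (suc k) ts lt a with initLast ts
... | [] = normal [] , refl , refl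
... | xs ∷ʳ′ S with ∷ʳ⁻ {xs = xs} a | sizeL-∷ʳ-parts xs S lt
...   | aXs , iS | ltXs , leS with Inner⇒Positive iS
...     | positive c zs =
  preserved-∷ʳ xs c zs iS (preserves-nrm k xs ltXs aXs) (preserves-nrm k zs leS (Inner-children iS))

preserves : ∀ {T} → Normal T → Preserved T
preserves (normal {ts} a) = preserves-nrm (suc (sizeL ts)) ts ≤-refl a

h-Normal : ∀ {T} → Normal T → Normal (h T)
h-Normal nT = proj₁ (preserves nT)

rpath-h : ∀ {T} → Normal T → rpath (h T) ≡ label T
rpath-h nT = proj₁ (proj₂ (preserves nT))

size-h : ∀ {T} → Normal T → size (h T) ≡ size T
size-h nT = proj₂ (proj₂ (preserves nT))

data _endsWith_ (P Q : Tree) : Set where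
  ends : ∀ W y → children P ≡ W ∷ʳ y → y ≈ᶜ Q → P endsWith Q

endsWith-last : ∀ {n W L Q} → node n (W ∷ʳ L) endsWith Q → L ≈ᶜ Q
endsWith-last {W = W} (ends W′ y e yQ) = trans (cong children (proj₂ (∷ʳ-injective W W′ e))) yQ

endsWith-rpath : ∀ {P Q} → P endsWith Q → rpath P ≡ suc (rpath Q)
endsWith-rpath {node n .(W ∷ʳ y)} (ends W y refl yQ) = trans (rpath-∷ʳ n W y) (cong suc (rpath-≈ yQ))

attachAt-endsWith : ∀ e s {P Q} → P endsWith Q → attachAt (suc e) s P endsWith attachAt e s Q
attachAt-endsWith e s {node n .(W ∷ʳ y)} (ends W y refl yQ) =
  ends W (attachAt e s y) (cong children (attachAt-∷ʳ e s n W y)) (attachAt-≈ e s yQ)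

last-child-step : ∀ xs e cs ys → Inner (node (suc e) cs) → h (nrm ys) endsWith h (nrm cs) →
  h (nrm (xs ∷ʳ node (suc (suc e)) ys)) endsWith h (nrm (xs ∷ʳ node (suc e) cs))
last-child-step xs e cs ys iX hys =
  subst₂ _endsWith_ (sym (h-shape xs (suc e) ys deep)) (sym (h-shape xs e cs shallow))
    (attachAt-endsWith e (setLabel 1 (h (nrm xs))) hys)
  where
  shallow : e ≤ rpath (h (nrm cs))
  shallow = subst (e ≤_) (sym (rpath-h (normal (Inner-children iX)))) (depth-≤ (Inner-depth iX))
  deep : suc e ≤ rpath (h (nrm ys))
  deep = subst (suc e ≤_) (sym (endsWith-rpath hys)) (s≤s shallow)

last-child : ∀ d X zs → All Inner (children X) → d ≤ rpath X →
  h (nrm (children (attachAt d (node 1 zs) X))) endsWith h (nrm (children X))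
last-child zero (node n ts) zs _ _ =
  subst (_endsWith h (nrm ts)) (sym (h-shape ts 0 zs z≤n))
    (ends (children (h (nrm zs))) s (children-attachAt₀ s (h (nrm zs))) (setLabel-≈ 1 (h (nrm ts))))
  where
  s = setLabel 1 (h (nrm ts))
last-child (suc d) (node n ts) zs a le with initLast ts
... | xs ∷ʳ′ x with ∷ʳ⁻ {xs = xs} a
...   | _ , iX with Inner⇒Positive iX
...     | positive e cs =
  subst (λ us → h (nrm us) endsWith h (nrm (xs ∷ʳ x)))
    (sym (trans (cong children (attachAt-∷ʳ d (node 1 zs) n xs x)) (cong (xs ∷ʳ_) y-eta)))
    (last-child-step xs e cs (children y) iX
      (last-child d x zs (Inner-children iX) (rpath-last n xs x le)))
  where
  y = attachAt d (node 1 zs) x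
  y-eta : y ≡ node (suc (suc e)) (children y)
  y-eta = label-eta y (label-attachAt d (node 1 zs) x (rpath-last n xs x le))

-- The tree formed by the root and the subtrees xs (the A, A₁ of (F1), (F2)).
planted : List Tree → Tree
planted [] = point
planted (t ∷ ts) = nrm (t ∷ ts)

planted-Beta : ∀ {xs} → All Inner xs → Beta (planted xs)
planted-Beta [] = single
planted-Beta (it ∷ a) = rooted refl (it ∷ a)

planted-h : ∀ xs → setLabel 1 (h (planted xs)) ≡ setLabel 1 (h (nrm xs))
planted-h [] = refl
planted-h (_ ∷ _) = refl

hangRight-planted : ∀ xs S → hangRight (planted xs) S ≡ nrm (xs ∷ʳ S)
hangRight-planted [] S = refl
hangRight-planted (_ ∷ _) S = refl

fixed-F1 : ∀ xs S H → All Inner xs →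
  nrm (xs ∷ʳ S) ≡ attachAt 0 (setLabel 1 (h (nrm xs))) H → IsF1 (nrm (xs ∷ʳ S))
fixed-F1 xs S H a fix = planted xs , planted-Beta a , (begin
  nrm (xs ∷ʳ S)                               ≡⟨ sym (hangRight-planted xs S) ⟩
  hangRight (planted xs) S                    ≡⟨ cong (hangRight (planted xs)) (trans S-eq (sym (planted-h xs))) ⟩
  F1tree (planted xs)                         ∎)
  where
  open ≡-Reasoning
  S-eq : S ≡ setLabel 1 (h (nrm xs))
  S-eq = proj₂ (∷ʳ-injective xs (children H) (trans (cong children fix) (children-attachAt₀ _ H)))

-- A fixed point whose rightmost child (of label b = suc (suc d)) is attached
-- at depth suc d has shape (F2); A₂ is the normalised last child L of
-- h (nrm zs), and it is a fixed point by 'last-child'.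
fixed-F2 : ∀ xs d zs H → All Inner xs → Normal H → h (nrm zs) ≡ H → suc d < rpath H →
  nrm (xs ∷ʳ node (suc (suc d)) zs) ≡ attachAt (suc d) (setLabel 1 (h (nrm xs))) H →
  IsF2 (nrm (xs ∷ʳ node (suc (suc d)) zs))
fixed-F2 xs d zs .(nrm hs) a (normal {hs} aH) hz lt fix with initLast hs
... | W ∷ʳ′ L with ∷ʳ⁻ {xs = W} aH | rpath-last (sumL (W ∷ʳ L)) W L lt
...   | _ , leaf | ()
...   | _ , internal {e} {l} {ls} _ q al | dL =
  planted xs , b , A₂ , planted-Beta a , s≤s (s≤s z≤n) , rooted refl al ,
  s≤s (≤-trans (size-pos l) (m≤m+n _ _)) , A₂-fixed , subst (_≤ sumL (l ∷ ls)) (sym e-eq) q ,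
  trans (sym (hangRight-planted xs _)) (cong (hangRight (planted xs)) (sym A₂′-eq))
  where
  open ≡-Reasoning
  b = suc (suc d)
  s = setLabel 1 (h (nrm xs))
  A₂ = nrm (l ∷ ls)
  S-eq : node b zs ≡ attachAt d s (node e (l ∷ ls))
  S-eq = proj₂ (∷ʳ-injective xs W (trans (cong children fix) (cong children (attachAt-∷ʳ d s _ W _))))
  e-eq : suc d ≡ e
  e-eq = suc-injective (trans (cong label S-eq) (label-attachAt d s _ (<⇒≤ dL)))
  zs-eq : zs ≡ children (attachAt d (node 1 (children (h (nrm xs)))) (node e (l ∷ ls)))
  zs-eq = trans (cong children S-eq) (cong (λ t → children (attachAt d t _)) (setLabel-children 1 (h (nrm xs))))
  H-ends : nrm (W ∷ʳ node e (l ∷ ls)) endsWith h A₂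
  H-ends = subst (_endsWith h A₂) hz
             (subst (λ us → h (nrm us) endsWith h A₂) (sym zs-eq) (last-child d _ (children (h (nrm xs))) al (<⇒≤ dL)))
  A₂-fixed : h A₂ ≡ A₂
  A₂-fixed = trans (Normal-eta (h-Normal (normal al))) (cong nrm (sym (endsWith-last H-ends)))
  A₂′-eq : A2′ (planted xs) b A₂ ≡ node b zs
  A₂′-eq = begin
    setLabel b (attachAt d (setLabel 1 (h (planted xs))) A₂)  ≡⟨ cong (λ t → setLabel b (attachAt d t A₂)) (planted-h xs) ⟩
    setLabel b (attachAt d s A₂)                              ≡⟨ setLabel-children b _ ⟩
    node b (children (attachAt d s A₂))                       ≡⟨ cong (node b) (attachAt-≈ d s {A₂} {node e (l ∷ ls)} refl) ⟩
    node b (children (attachAt d s (node e (l ∷ ls))))        ≡⟨ cong (node b) (sym (cong children S-eq)) ⟩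
    node b zs                                                 ∎

classify-∷ʳ : ∀ xs S → All Inner (xs ∷ʳ S) → h (nrm (xs ∷ʳ S)) ≡ nrm (xs ∷ʳ S) →
  IsF1 (nrm (xs ∷ʳ S)) ⊎ IsF2 (nrm (xs ∷ʳ S))
classify-∷ʳ xs S a fix with ∷ʳ⁻ {xs = xs} a
... | aXs , iS with Inner⇒Positive iS
...   | positive zero zs = inj₁ (fixed-F1 xs S (h (nrm zs)) aXs (trans (sym fix) (h-shape xs 0 zs z≤n)))
...   | positive (suc d) zs =
  inj₂ (fixed-F2 xs d zs (h (nrm zs)) aXs (h-Normal nZ) refl deep (trans (sym fix) (h-shape xs (suc d) zs (<⇒≤ deep))))
  where
  nZ : Normal (nrm zs)
  nZ = normal (Inner-children iS)
  deep : suc d < rpath (h (nrm zs))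
  deep = subst (suc d <_) (sym (rpath-h nZ)) (Inner-depth-< iS)

classify : ∀ T → Beta T → h T ≡ T → IsF0 T ⊎ IsF1 T ⊎ IsF2 T
classify _ single _ = inj₁ refl
classify (node _ (t ∷ ts)) (rooted refl a) fix =
  inj₂ (∷ʳ-elim (λ ys → All Inner ys → h (nrm ys) ≡ nrm ys → IsF1 (nrm ys) ⊎ IsF2 (nrm ys))
          classify-∷ʳ t ts a fix)

children-hangRight : ∀ A X → children (hangRight A X) ≡ children A ∷ʳ X
children-hangRight (node _ _) X = refl

size-hangRight : ∀ A X → size (hangRight A X) ≡ size A + size X
size-hangRight (node _ as) X = cong suc (sizeL-∷ʳ as X)

hangRight≢point : ∀ A X → hangRight A X ≢ point
hangRight≢point A X eq with ++-conicalʳ (children A) (X ∷ []) (trans (sym (children-hangRight A X)) (cong children eq))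
... | ()

-- (F1) and (F2) differ in the label of the last child of the root: 1 versus b ≥ 2.
F1≢F2 : ∀ A A₁ b A₂ → 2 ≤ b → F1tree A ≢ F2tree A₁ b A₂
F1≢F2 A A₁ b A₂ (s≤s (s≤s _)) eq with
  trans (sym (label-setLabel 1 (h A)))
    (trans (cong label (proj₂ (∷ʳ-injective (children A) (children A₁)
      (trans (sym (children-hangRight A _)) (trans (cong children eq) (children-hangRight A₁ _))))))
      (label-setLabel b (attachAt (b ∸ 2) (setLabel 1 (h A₁)) A₂)))
... | ()

Beta-size-h : ∀ {A} → Beta A → size (h A) ≡ size A
Beta-size-h single = refl
Beta-size-h (rooted refl a) = size-h (normal a)

Beta⇒Normal : ∀ {A} → Beta A → 2 ≤ size A → Normal A
Beta⇒Normal single (s≤s ())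
Beta⇒Normal (rooted refl a) _ = normal a

size-F1 : ∀ {A} → Beta A → size (F1tree A) ≡ size A + size A
size-F1 {A} bA = trans (size-hangRight A _) (cong (size A +_) (trans (size-setLabel 1 (h A)) (Beta-size-h bA)))

-- For (F2) the attachment depth b ∸ 2 must lie on the rightmost path of A₂.
size-F2 : ∀ {A₁ b A₂} → Beta A₁ → b ∸ 2 ≤ rpath A₂ → size (F2tree A₁ b A₂) ≡ size A₁ + (size A₂ + size A₁)
size-F2 {A₁} {b} {A₂} bA₁ le = trans (size-hangRight A₁ _) (cong (size A₁ +_) (begin
  size (setLabel b (attachAt (b ∸ 2) s A₂))  ≡⟨ size-setLabel b _ ⟩
  size (attachAt (b ∸ 2) s A₂)               ≡⟨ size-attachAt (b ∸ 2) s A₂ le ⟩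
  size A₂ + size s                           ≡⟨ cong (size A₂ +_) (trans (size-setLabel 1 (h A₁)) (Beta-size-h bA₁)) ⟩
  size A₂ + size A₁                          ∎))
  where
  open ≡-Reasoning
  s = setLabel 1 (h A₁)

double-even : ∀ n → 2 ∣ n + n
double-even n = subst (2 ∣_) (cong (n +_) (+-identityʳ n)) (m∣m*n n)

-- Every fixed point other than the one-node tree has an even number of nodes:
-- (F1) has 2·|A| nodes and (F2) has 2·|A₁| + |A₂| nodes with A₂ a smaller fixed point.
fixed-even : ∀ k T → size T ≤ k → Beta T → h T ≡ T → ¬ (T ≡ point) → 2 ∣ size T
fixed-even zero (node _ _) () _ _ _
fixed-even (suc k) T le bT fix T≢point with classify T bT fix
... | inj₁ T≡point = ⊥-elim (T≢point T≡point)
... | inj₂ (inj₁ (A , bA , refl)) = subst (2 ∣_) (sym (size-F1 bA)) (double-even (size A))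
... | inj₂ (inj₂ (A₁ , suc (suc d) , A₂ , bA₁ , s≤s (s≤s z≤n) , bA₂ , big , A₂-fixed , lab , refl)) =
  subst (2 ∣_) (sym size-eq) (∣m∣n⇒∣m+n (double-even (size A₁)) (fixed-even k A₂ smaller bA₂ A₂-fixed A₂≢point))
  where
  reach : d ≤ rpath A₂
  reach = subst (d ≤_) (sym (trans (cong rpath (sym A₂-fixed)) (rpath-h (Beta⇒Normal bA₂ big)))) (≤-trans (n≤1+n d) lab)
  size-eq : size (F2tree A₁ (suc (suc d)) A₂) ≡ size A₁ + size A₁ + size A₂
  size-eq = trans (size-F2 bA₁ reach)
              (trans (cong (size A₁ +_) (+-comm (size A₂) (size A₁))) (sym (+-assoc (size A₁) _ _)))
  smaller : size A₂ ≤ k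
  smaller = ≤-pred (≤-trans (m<n+m (size A₂) (≤-trans (size-pos A₁) (m≤m+n _ _))) (subst (_≤ suc k) size-eq le))
  A₂≢point : ¬ (A₂ ≡ point)
  A₂≢point A₂≡point = 1+n≰n (subst (λ t → 2 ≤ size t) A₂≡point big)

theorem3 : (T : Tree) → Beta T → h T ≡ T →
    ((IsF0 T ⊎ IsF1 T ⊎ IsF2 T) × ¬ (IsF0 T × IsF1 T) × ¬ (IsF0 T × IsF2 T) × ¬ (IsF1 T × IsF2 T))
    × (¬ (T ≡ point) → 2 ∣ size T)
theorem3 T bT fix = (classify T bT fix , F0-F1 , F0-F2 , F1-F2) , fixed-even (size T) T ≤-refl bT fix
  where
  F0-F1 : ¬ (IsF0 T × IsF1 T)
  F0-F1 (T≡point , A , _ , T≡F1) = hangRight≢point A _ (trans (sym T≡F1) T≡point)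
  F0-F2 : ¬ (IsF0 T × IsF2 T)
  F0-F2 (T≡point , A₁ , _ , _ , _ , _ , _ , _ , _ , _ , T≡F2) = hangRight≢point A₁ _ (trans (sym T≡F2) T≡point)
  F1-F2 : ¬ (IsF1 T × IsF2 T)
  F1-F2 ((A , _ , T≡F1) , (A₁ , b , A₂ , _ , 2≤b , _ , _ , _ , _ , T≡F2)) = F1≢F2 A A₁ b A₂ 2≤b (trans (sym T≡F1) T≡F2)
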